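{- For all integers $n\ge 2$ and $r,s\ge 1$, $\chi_{la}\big((2r+1)[(2s+1)P_2\vee O_{2n}]\big)=3$.
   Context: For a graph $G$ with $q$ edges, a bijection $f:E(G)\to\{1,\dots,q\}$ is a local antimagic labeling if $f^+(u)\neq f^+(v)$ for every edge $uv$, where $f^+(u)$ is the sum of the labels of edges incident to $u$; $\chi_{la}(G)$ is the minimum number of distinct values of $f^+$ over all local antimagic labelings of $G$. $O_m$ is the null graph on $m$ vertices, $aP_2$ is the disjoint union of $a$ copies of $P_2$ (a single edge), $G\vee H$ is the join of $G$ and $H$, and $(2r+1)[G]$ denotes the disjoint union of $2r+1$ copies of $G$. -}

module Defs where

open import Data.Nat using (ℕ; zero; suc; _+_; _*_; _≤_)
open import Data.Nat.Properties using () renaming (_≟_ to _≟ℕ_)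
open import Data.Fin using (Fin; zero; suc; toℕ; splitAt; _↑ˡ_; _↑ʳ_; remQuot)
open import Data.Fin.Properties using () renaming (_≟_ to _≟F_)
open import Data.Nat.ListAction using (sum)
open import Data.List using (List; map; allFin; length; deduplicate)
open import Data.Product using (_×_; _,_; proj₁; proj₂; ∃)
open import Data.Sum using (inj₁; inj₂)
open import Data.Bool using (if_then_else_; _∨_)
open import Relation.Nullary using (¬_)
open import Relation.Nullary.Decidable using (⌊_⌋)
open import Data.Sum using (_⊎_)
open import Relation.Binary.PropositionalEquality using (_≡_)
open import Function.Definitions using (Bijective)

record Graph : Set where
  constructor mkGraph
  field
    V    : ℕ
    q    : ℕ
    ends : Fin q → Fin V × Fin V
open Graph public

O : ℕ → Graph
O m = mkGraph m 0 (λ ())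

P₂ : Graph
P₂ = mkGraph 2 1 (λ _ → zero , suc zero)

_⊕_ : Graph → Graph → Graph
G ⊕ H = mkGraph (V G + V H) (q G + q H) e
  where
  e : Fin (q G + q H) → Fin (V G + V H) × Fin (V G + V H)
  e i with splitAt (q G) i
  ... | inj₁ j = (proj₁ (ends G j) ↑ˡ V H) , (proj₂ (ends G j) ↑ˡ V H)
  ... | inj₂ j = (V G ↑ʳ proj₁ (ends H j)) , (V G ↑ʳ proj₂ (ends H j))

copies : ℕ → Graph → Graph
copies zero    G = O 0
copies (suc k) G = G ⊕ copies k G

_∨G_ : Graph → Graph → Graph
G ∨G H = mkGraph (V G + V H) ((q G + q H) + V G * V H) e
  where
  e : Fin ((q G + q H) + V G * V H) → Fin (V G + V H) × Fin (V G + V H)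
  e i with splitAt (q G + q H) i
  ... | inj₁ j = ends (G ⊕ H) j
  ... | inj₂ j = (proj₁ (remQuot {V G} (V H) j) ↑ˡ V H) , (V G ↑ʳ proj₂ (remQuot {V G} (V H) j))

-- f : Fin q → Fin q is the labelling; edge e gets label  toℕ (f e) + 1  ∈ {1..q}
label : {q : ℕ} → (Fin q → Fin q) → Fin q → ℕ
label f e = suc (toℕ (f e))

fplus : (G : Graph) → (Fin (q G) → Fin (q G)) → Fin (V G) → ℕ
fplus G f u = sum (map (λ e → if ⌊ proj₁ (ends G e) ≟F u ⌋ ∨ ⌊ proj₂ (ends G e) ≟F u ⌋
                                then label f e else 0)
                       (allFin (q G)))

IsLocalAntimagic : (G : Graph) → (Fin (q G) → Fin (q G)) → Set
IsLocalAntimagic G f =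
  Bijective _≡_ _≡_ f ×
  ((e : Fin (q G)) → ¬ (fplus G f (proj₁ (ends G e)) ≡ fplus G f (proj₂ (ends G e))))

numColours : (G : Graph) → (Fin (q G) → Fin (q G)) → ℕ
numColours G f = length (deduplicate _≟ℕ_ (map (fplus G f) (allFin (V G))))

LocalAntimagicChromaticNumber : Graph → ℕ → Set
LocalAntimagicChromaticNumber G k =
  (∃ λ f → IsLocalAntimagic G f × numColours G f ≡ k) ×
  (∀ f → IsLocalAntimagic G f → k ≤ numColours G f)

module Submission where

-- Write R = 2r + 1, K = 2s + 1 and N = 2n.  A copy of (2s + 1)P₂ ∨ O_2n has K rungs (the edges of
-- (2s + 1)P₂), N hubs (the vertices of O_2n), and a spoke from each end of each rung to each hub.
-- Edge (t, e, σ), i.e. slot σ (the rung or one of its spokes) of rung e in copy t, is labelled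
-- 1 + offset + R · (position + K · block): the block depends only on σ, position ∈ [0, 2s] permutes
-- the rungs and offset ∈ [0, 2r] permutes the copies.  Positions and offsets are read off the rows
-- of 3 × (2h + 1) Kotzig arrays (every column sums to 3h) and of complementary pairs t, 2h − t,
-- arranged so that the vertex sum is the same at all ends of side 0, at all ends of side 1 and at
-- all hubs.  Comparing these three sums (their order depends on n versus K) shows they are
-- distinct.  Conversely, a rung and a hub span a triangle, so at least three colours are needed.

open import Defs
open import Data.Bool using (Bool; true; false; not; if_then_else_; _∨_; T)
open import Data.Bool.Properties using (∨-identityʳ)
open import Data.Fin using (Fin; zero; suc; toℕ; fromℕ<; punchOut; splitAt; _↑ˡ_; _↑ʳ_; combine; remQuot)
open import Data.Fin.Patterns using (0F; 1F; 2F)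
open import Data.Fin.Properties
  using (toℕ<n; toℕ-injective; toℕ-fromℕ<; ↑ˡ-injective; ↑ʳ-injective;
         splitAt-↑ˡ; splitAt-↑ʳ; splitAt⁻¹-↑ˡ; splitAt⁻¹-↑ʳ; remQuot-combine; combine-remQuot;
         punchOut-injective; injective⇒≤; any?)
  renaming (_≟_ to _≟ᶠ_; suc-injective to sucᶠ-injective)
open import Data.List using (List; []; _∷_; length; map; tabulate; allFin; deduplicate; lookup)
open import Data.List.Membership.Propositional using (_∈_)
open import Data.List.Membership.Propositional.Properties
  using (∈-map⁺; ∈-map⁻; ∈-allFin; ∈-deduplicate⁺; ∈-deduplicate⁻; ∈-lookup)
open import Data.List.Relation.Unary.All as All using ([]; _∷_)
open import Data.List.Relation.Unary.AllPairs using ([]; _∷_)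
open import Data.List.Relation.Unary.Any using (here; there; index)
open import Data.List.Relation.Unary.Unique.Propositional using (Unique)
open import Data.List.Relation.Unary.Unique.DecPropositional.Properties using (deduplicate-!)
open import Data.Nat
open import Data.Nat.DivMod using (_%_; [m+kn]%n≡m%n; m<n⇒m%n≡m)
open import Data.Nat.ListAction using () renaming (sum to sumList)
open import Data.Nat.Properties
open import Data.Nat.Tactic.RingSolver using (solve-∀)
open import Algebra.Properties.Semiring.Sum +-*-semiring
  using (sum; sum-syntax; sum-cong-≗; ∑-distrib-+; *-distribˡ-sum; sum-replicate-zero)
open import Data.Product using (_×_; _,_; proj₁; proj₂)
open import Data.Sum using (inj₁; inj₂)
open import Data.Unit using (tt)
open import Function using (_∘_; id; case_of_)
open import Function.Definitions using (Injective; Surjective; Bijective)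
open import Relation.Binary.Definitions using (tri<; tri≈; tri>)
open import Relation.Binary.PropositionalEquality
open import Relation.Nullary using (yes; no; contradiction)
open import Relation.Nullary.Decidable using (⌊_⌋; isYes≗does; dec-true; dec-false)

∑-const : ∀ n c → ∑[ i < n ] c ≡ n * c
∑-const zero    c = refl
∑-const (suc n) c = cong (c +_) (∑-const n c)

∑-split : ∀ m n (g : Fin (m + n) → ℕ) →
          ∑[ k < m + n ] g k ≡ ∑[ i < m ] g (i ↑ˡ n) + ∑[ j < n ] g (m ↑ʳ j)
∑-split zero    n g = refl
∑-split (suc m) n g = trans (cong (g zero +_) (∑-split m n (g ∘ suc))) (sym (+-assoc (g zero) _ _))

∑-combine : ∀ m n (g : Fin (m * n) → ℕ) →
            ∑[ k < m * n ] g k ≡ ∑[ i < m ] ∑[ j < n ] g (combine i j)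
∑-combine zero    n g = refl
∑-combine (suc m) n g = trans (∑-split n (m * n) g) (cong (∑[ j < n ] g (j ↑ˡ m * n) +_) (∑-combine m n (g ∘ (n ↑ʳ_))))

sumBelow : ℕ → (ℕ → ℕ) → ℕ
sumBelow m g = ∑[ i < m ] g (toℕ i)

sumBelow-+ : ∀ m n g → sumBelow (m + n) g ≡ sumBelow m g + sumBelow n (λ i → g (m + i))
sumBelow-+ zero    n g = refl
sumBelow-+ (suc m) n g = trans (cong (g 0 +_) (sumBelow-+ m n (g ∘ suc))) (sym (+-assoc (g 0) _ _))

sumBelow-pairs : ∀ m {c} (g : ℕ → ℕ) → (∀ i → g i + g (suc i) ≡ c) → sumBelow (m * 2) g ≡ m * c
sumBelow-pairs zero    g pair = refl
sumBelow-pairs (suc m) g pair = begin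
  g 0 + (g 1 + sumBelow (m * 2) (λ i → g (2 + i)))  ≡⟨ +-assoc (g 0) (g 1) _ ⟨
  g 0 + g 1 + sumBelow (m * 2) (λ i → g (2 + i))    ≡⟨ cong₂ _+_ (pair 0) (sumBelow-pairs m (λ i → g (2 + i)) (pair ∘ (2 +_))) ⟩
  _ + m * _                                          ∎
  where open ≡-Reasoning

sumBelow-cong : ∀ m {f g : ℕ → ℕ} → (∀ i → i < m → f i ≡ g i) → sumBelow m f ≡ sumBelow m g
sumBelow-cong m f≗g = sum-cong-≗ (λ i → f≗g (toℕ i) (toℕ<n i))

sumBelow-suc : ∀ m → sumBelow m (1 +_) ≡ m + sumBelow m id
sumBelow-suc m = trans (∑-distrib-+ (λ _ → 1) (toℕ {m})) (cong (_+ sumBelow m id) (trans (∑-const m 1) (*-identityʳ m)))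

sumBelow-reverse : ∀ m → sumBelow m (λ i → m ∸ suc i) ≡ sumBelow m id
sumBelow-reverse zero    = refl
sumBelow-reverse (suc m) = trans (cong (m +_) (sumBelow-reverse m)) (sym (sumBelow-suc m))

gauss : ∀ m → 2 * sumBelow m id + m ≡ m * m
gauss zero    = refl
gauss (suc m) = begin
  2 * sumBelow m (1 +_) + suc m        ≡⟨ cong (λ x → 2 * x + suc m) (sumBelow-suc m) ⟩
  2 * (m + sumBelow m id) + suc m      ≡⟨ step m (sumBelow m id) ⟩
  (2 * sumBelow m id + m) + 2 * m + 1  ≡⟨ cong (λ x → x + 2 * m + 1) (gauss m) ⟩
  m * m + 2 * m + 1                    ≡⟨ square m ⟩
  suc m * suc m                        ∎
  where
  open ≡-Reasoning
  step : ∀ m S → 2 * (m + S) + suc m ≡ (2 * S + m) + 2 * m + 1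
  step = solve-∀
  square : ∀ m → m * m + 2 * m + 1 ≡ suc m * suc m
  square = solve-∀

sumBelow-affine : ∀ m a b (g : ℕ → ℕ) → sumBelow m (λ i → a + b * g i) ≡ m * a + b * sumBelow m g
sumBelow-affine m a b g = trans (∑-distrib-+ {m} (λ _ → a) (λ i → b * g (toℕ i)))
  (cong₂ _+_ (∑-const m a) (sym (*-distribˡ-sum {m} b (λ i → g (toℕ i)))))

≤⇒≤ᵇ≡true : ∀ {m n} → m ≤ n → (m ≤ᵇ n) ≡ true
≤⇒≤ᵇ≡true {m} {n} m≤n with m ≤ᵇ n in eq
... | true  = refl
... | false = case subst T eq (≤⇒≤ᵇ m≤n) of λ ()

>⇒≤ᵇ≡false : ∀ {m n} → n < m → (m ≤ᵇ n) ≡ false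
>⇒≤ᵇ≡false {m} {n} n<m with m ≤ᵇ n in eq
... | false = refl
... | true  = contradiction (≤ᵇ⇒≤ m n (subst T (sym eq) tt)) (<⇒≱ n<m)

m+k≡n⇒m≤n : ∀ {m n} k → m + k ≡ n → m ≤ n
m+k≡n⇒m≤n {m} k eq = m+n≤o⇒m≤o m (≤-reflexive eq)

0<odd : ∀ m → 0 < 2 * m + 1
0<odd m = subst (0 <_) (+-comm 1 (2 * m)) z<s

+-*-injective : ∀ {n o o′ b b′} → o < n → o′ < n → o + n * b ≡ o′ + n * b′ → o ≡ o′ × b ≡ b′
+-*-injective {suc n} {o} {o′} {b} {b′} o< o′< eq =
  o≡o′ , *-cancelˡ-≡ b b′ (suc n) (+-cancelˡ-≡ o _ _ (trans eq (cong (_+ suc n * b′) (sym o≡o′))))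
  where
  remainder : ∀ {x} c → x < suc n → (x + suc n * c) % suc n ≡ x
  remainder {x} c x< = trans (cong (λ y → (x + y) % suc n) (*-comm (suc n) c))
                             (trans ([m+kn]%n≡m%n x c (suc n)) (m<n⇒m%n≡m x<))
  o≡o′ : o ≡ o′
  o≡o′ = trans (sym (remainder b o<)) (trans (cong (_% suc n) eq) (remainder b′ o′<))

+-*-< : ∀ {n m o b} → o < n → b < m → o + n * b < n * m
+-*-< {n} {m} {o} {b} o< b< = begin-strict
  o + n * b   <⟨ +-monoˡ-< (n * b) o< ⟩
  n + n * b   ≡⟨ *-suc n b ⟨
  n * suc b   ≤⟨ *-monoʳ-≤ n b< ⟩
  n * m       ∎
  where open ≤-Reasoning

toℕ≤pred[2h+1] : ∀ h (i : Fin (2 * h + 1)) → toℕ i ≤ 2 * h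
toℕ≤pred[2h+1] h i = m<1+n⇒m≤n (subst (toℕ i <_) (+-comm (2 * h) 1) (toℕ<n i))

injective⇒surjective : ∀ {n} (f : Fin n → Fin n) → Injective _≡_ _≡_ f → Surjective _≡_ _≡_ f
injective⇒surjective {suc n} f f-inj y with any? (λ x → f x ≟ᶠ y)
... | yes (x , fx≡y) = x , λ { refl → fx≡y }
... | no  missed     = contradiction (injective⇒≤ avoid-injective) (<-irrefl refl)
  where
  y≢f : ∀ x → y ≢ f x
  y≢f x y≡fx = missed (x , sym y≡fx)
  avoid : Fin (suc n) → Fin n
  avoid x = punchOut (y≢f x)
  avoid-injective : Injective _≡_ _≡_ avoid
  avoid-injective {x} {x′} eq = f-inj (punchOut-injective (y≢f x) (y≢f x′) eq)

-- Kotzig arrays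

mirror : ℕ → ℕ → ℕ
mirror h t = 2 * h ∸ t

-- rotate h is t ↦ t + h mod 2h + 1, and for t ≤ 2h the columns (t, rotate h t, kotzig h t) form a
-- 3 × (2h + 1) Kotzig array: every row permutes {0, …, 2h} and every column sums to 3h.
rotate : ℕ → ℕ → ℕ
rotate h t = if t ≤ᵇ h then t + h else t ∸ suc h

kotzig : ℕ → ℕ → ℕ
kotzig h t = if t ≤ᵇ h then 2 * (h ∸ t) else suc (2 * (2 * h ∸ t))

data Half (h : ℕ) : ℕ → Set where
  lower : ∀ {t} d → h ≡ t + d → Half h t
  upper : ∀ d e → h ≡ suc (d + e) → Half h (suc h + d)

half : ∀ h t → t ≤ 2 * h → Half h t
half h t t≤2h with t ≤? h
... | yes t≤h = lower (h ∸ t) (sym (m+[n∸m]≡n t≤h))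
... | no  t≰h = subst (Half h) t≡ (upper d (h ∸ suc d) (sym (m+[n∸m]≡n d<h)))
  where
  d = t ∸ suc h
  t≡ : suc h + d ≡ t
  t≡ = m+[n∸m]≡n (≰⇒> t≰h)
  d<h : d < h
  d<h = +-cancelˡ-≤ h (suc d) h
          (subst₂ _≤_ (sym (trans (+-suc h d) t≡)) (cong (h +_) (+-identityʳ h)) t≤2h)

rotate-lower : ∀ {h t} d → h ≡ t + d → rotate h t ≡ t + h
rotate-lower {t = t} d refl rewrite ≤⇒≤ᵇ≡true (m≤m+n t d) = refl

rotate-upper : ∀ h d → rotate h (suc h + d) ≡ d
rotate-upper h d rewrite >⇒≤ᵇ≡false (m≤m+n (suc h) d) = m+n∸m≡n (suc h) d

kotzig-lower : ∀ {h t} d → h ≡ t + d → kotzig h t ≡ 2 * d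
kotzig-lower {t = t} d refl rewrite ≤⇒≤ᵇ≡true (m≤m+n t d) = cong (2 *_) (m+n∸m≡n t d)

kotzig-upper : ∀ {h} d e → h ≡ suc (d + e) → kotzig h (suc h + d) ≡ suc (2 * e)
kotzig-upper {h} d e refl rewrite >⇒≤ᵇ≡false (m≤m+n (suc h) d) =
  trans (cong (λ x → suc (2 * (x ∸ (suc h + d)))) (double d e))
        (cong (λ x → suc (2 * x)) (m+n∸m≡n (suc h + d) e))
  where
  double : ∀ d e → 2 * suc (d + e) ≡ suc (suc (d + e)) + d + e
  double = solve-∀

kotzig-column : ∀ h t → t ≤ 2 * h → t + rotate h t + kotzig h t ≡ 3 * h
kotzig-column h t t≤ with half h t t≤
... | lower d p rewrite rotate-lower d p | kotzig-lower d p =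
  subst (λ h → t + (t + h) + 2 * d ≡ 3 * h) (sym p) (lowerSum t d)
  where
  lowerSum : ∀ t d → t + (t + (t + d)) + 2 * d ≡ 3 * (t + d)
  lowerSum = solve-∀
... | upper d e p rewrite rotate-upper h d | kotzig-upper d e p =
  subst (λ h → suc h + d + d + suc (2 * e) ≡ 3 * h) (sym p) (upperSum d e)
  where
  upperSum : ∀ d e → suc (suc (d + e)) + d + d + suc (2 * e) ≡ 3 * suc (d + e)
  upperSum = solve-∀

rotate-≤ : ∀ h t → t ≤ 2 * h → rotate h t ≤ 2 * h
rotate-≤ h t t≤ with half h t t≤
... | lower d p rewrite rotate-lower d p =
  m+k≡n⇒m≤n d (subst (λ h → t + h + d ≡ 2 * h) (sym p) (lowerBound t d))
  where
  lowerBound : ∀ t d → t + (t + d) + d ≡ 2 * (t + d)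
  lowerBound = solve-∀
... | upper d e p rewrite rotate-upper h d =
  m+k≡n⇒m≤n (d + 2 * e + 2) (subst (λ h → d + (d + 2 * e + 2) ≡ 2 * h) (sym p) (upperBound d e))
  where
  upperBound : ∀ d e → d + (d + 2 * e + 2) ≡ 2 * suc (d + e)
  upperBound = solve-∀

kotzig-≤ : ∀ h t → t ≤ 2 * h → kotzig h t ≤ 2 * h
kotzig-≤ h t t≤ with half h t t≤
... | lower d p rewrite kotzig-lower d p = *-monoʳ-≤ 2 (m+k≡n⇒m≤n t (trans (+-comm d t) (sym p)))
... | upper d e p rewrite kotzig-upper d e p =
  m+k≡n⇒m≤n (1 + 2 * d) (subst (λ h → suc (2 * e) + (1 + 2 * d) ≡ 2 * h) (sym p) (upperBound d e))
  where
  upperBound : ∀ d e → suc (2 * e) + (1 + 2 * d) ≡ 2 * suc (d + e)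
  upperBound = solve-∀

rotate-lower≢upper : ∀ {h t} d d′ e′ → h ≡ t + d → h ≡ suc (d′ + e′) → rotate h t ≢ rotate h (suc h + d′)
rotate-lower≢upper {h} {t} d d′ e′ p p′ eq =
  m≢1+n+m d′ (trans (sym (trans (sym (rotate-lower d p)) (trans eq (rotate-upper h d′))))
                    (trans (cong (t +_) p′) (split t d′ e′)))
  where
  split : ∀ t d e → t + suc (d + e) ≡ suc ((t + e) + d)
  split = solve-∀

rotate-injective : ∀ h {a b} → a ≤ 2 * h → b ≤ 2 * h → rotate h a ≡ rotate h b → a ≡ b
rotate-injective h {a} {b} a≤ b≤ eq with half h a a≤ | half h b b≤
... | lower d p   | lower d′ p′    =
  +-cancelʳ-≡ h a b (trans (sym (rotate-lower d p)) (trans eq (rotate-lower d′ p′)))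
... | upper d e _ | upper d′ e′ _ =
  cong (suc h +_) (trans (sym (rotate-upper h d)) (trans eq (rotate-upper h d′)))
... | lower d p   | upper d′ e′ p′ = contradiction eq (rotate-lower≢upper d d′ e′ p p′)
... | upper d e p | lower d′ p′    = contradiction (sym eq) (rotate-lower≢upper d′ d e p′ p)

kotzig-injective : ∀ h {a b} → a ≤ 2 * h → b ≤ 2 * h → kotzig h a ≡ kotzig h b → a ≡ b
kotzig-injective h {a} {b} a≤ b≤ eq with half h a a≤ | half h b b≤
... | lower d p   | lower d′ p′    =
  +-cancelʳ-≡ d a b (trans (sym p) (trans p′ (cong (b +_) (sym d≡d′))))
  where
  d≡d′ : d ≡ d′
  d≡d′ = *-cancelˡ-≡ d d′ 2 (trans (sym (kotzig-lower d p)) (trans eq (kotzig-lower d′ p′)))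
... | upper d e p | upper d′ e′ p′ = cong (suc h +_) d≡d′
  where
  e≡e′ : e ≡ e′
  e≡e′ = *-cancelˡ-≡ e e′ 2 (suc-injective (trans (sym (kotzig-upper d e p)) (trans eq (kotzig-upper d′ e′ p′))))
  d≡d′ : d ≡ d′
  d≡d′ = +-cancelʳ-≡ e d d′ (trans (suc-injective (trans (sym p) p′)) (cong (d′ +_) (sym e≡e′)))
... | lower d p   | upper d′ e′ p′ =
  contradiction (trans (sym (kotzig-lower d p)) (trans eq (kotzig-upper d′ e′ p′))) (even≢odd d e′)
... | upper d e p | lower d′ p′    =
  contradiction (trans (sym (kotzig-lower d′ p′)) (trans (sym eq) (kotzig-upper d e p))) (even≢odd d′ e)

mirror-≤ : ∀ h t → mirror h t ≤ 2 * h
mirror-≤ h t = m∸n≤m (2 * h) t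

mirror-injective : ∀ h {a b} → a ≤ 2 * h → b ≤ 2 * h → mirror h a ≡ mirror h b → a ≡ b
mirror-injective h = ∸-cancelˡ-≡

+-mirror : ∀ h {t} → t ≤ 2 * h → t + mirror h t ≡ 2 * h
+-mirror h = m+[n∸m]≡n

mirror-column : ∀ h {x y z} → x ≤ 2 * h → y ≤ 2 * h → z ≤ 2 * h →
                x + y + z ≡ 3 * h → mirror h x + mirror h y + mirror h z ≡ 3 * h
mirror-column h {x} {y} {z} x≤ y≤ z≤ xyz = +-cancelʳ-≡ (3 * h) _ _ (begin
  mirror h x + mirror h y + mirror h z + 3 * h
    ≡⟨ cong (mirror h x + mirror h y + mirror h z +_) xyz ⟨
  mirror h x + mirror h y + mirror h z + (x + y + z)
    ≡⟨ regroup x y z (mirror h x) (mirror h y) (mirror h z) ⟩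
  (x + mirror h x) + (y + mirror h y) + (z + mirror h z)
    ≡⟨ cong₂ (λ a b → a + b + (z + mirror h z)) (+-mirror h x≤) (+-mirror h y≤) ⟩
  2 * h + 2 * h + (z + mirror h z)
    ≡⟨ cong (2 * h + 2 * h +_) (+-mirror h z≤) ⟩
  2 * h + 2 * h + 2 * h
    ≡⟨ six h ⟩
  3 * h + 3 * h ∎)
  where
  open ≡-Reasoning
  regroup : ∀ x y z x′ y′ z′ → x′ + y′ + z′ + (x + y + z) ≡ (x + x′) + (y + y′) + (z + z′)
  regroup = solve-∀
  six : ∀ h → 2 * h + 2 * h + 2 * h ≡ 3 * h + 3 * h
  six = solve-∀

sumBelow-mirror : ∀ h → sumBelow (suc (2 * h)) (mirror h) ≡ sumBelow (suc (2 * h)) id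
sumBelow-mirror h = sumBelow-reverse (suc (2 * h))

sumBelow-rotate : ∀ h → sumBelow (suc (2 * h)) (rotate h) ≡ sumBelow (suc (2 * h)) id
sumBelow-rotate h = begin
  sumBelow (suc (2 * h)) (rotate h)
    ≡⟨ cong (λ m → sumBelow m (rotate h)) halves ⟩
  sumBelow (suc h + h) (rotate h)
    ≡⟨ sumBelow-+ (suc h) h (rotate h) ⟩
  sumBelow (suc h) (rotate h) + sumBelow h (λ d → rotate h (suc h + d))
    ≡⟨ cong₂ _+_ (sumBelow-cong (suc h) (λ t t≤h → rotate-lower (h ∸ t) (sym (m+[n∸m]≡n (s≤s⁻¹ t≤h)))))
                 (sumBelow-cong h (λ d _ → rotate-upper h d)) ⟩
  sumBelow (suc h) (λ t → t + h) + sumBelow h id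
    ≡⟨ cong (_+ sumBelow h id) (trans (∑-distrib-+ {suc h} toℕ (λ _ → h)) (cong (sumBelow (suc h) id +_) (∑-const (suc h) h))) ⟩
  sumBelow (suc h) id + suc h * h + sumBelow h id
    ≡⟨ trans (+-assoc (sumBelow (suc h) id) _ _) (cong (λ x → sumBelow (suc h) id + (x + sumBelow h id)) (*-comm (suc h) h)) ⟩
  sumBelow (suc h) id + (h * suc h + sumBelow h id)
    ≡⟨ cong (sumBelow (suc h) id +_) (trans (∑-distrib-+ {h} (λ _ → suc h) toℕ) (cong (_+ sumBelow h id) (∑-const h (suc h)))) ⟨
  sumBelow (suc h) id + sumBelow h (λ d → suc h + d)
    ≡⟨ sumBelow-+ (suc h) h id ⟨
  sumBelow (suc h + h) id
    ≡⟨ cong (λ m → sumBelow m id) halves ⟨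
  sumBelow (suc (2 * h)) id ∎
  where
  open ≡-Reasoning
  halves : suc (2 * h) ≡ suc h + h
  halves = cong suc (cong (h +_) (+-identityʳ h))

sumBelow-odd : ∀ h → sumBelow (suc (2 * h)) id ≡ h * suc (2 * h)
sumBelow-odd h = *-cancelˡ-≡ _ _ 2 (+-cancelʳ-≡ (suc (2 * h)) _ _ (trans (gauss (suc (2 * h))) (square h)))
  where
  square : ∀ h → suc (2 * h) * suc (2 * h) ≡ 2 * (h * suc (2 * h)) + suc (2 * h)
  square = solve-∀

Kind : Set
Kind = Fin 3 × Bool

kotzigRow : Fin 3 → ℕ → ℕ → ℕ
kotzigRow 0F h t = t
kotzigRow 1F h t = rotate h t
kotzigRow 2F h t = kotzig h t

permute : Kind → ℕ → ℕ → ℕ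
permute (i , false) h t = kotzigRow i h t
permute (i , true)  h t = mirror h (kotzigRow i h t)

kotzigRow-≤ : ∀ i h {t} → t ≤ 2 * h → kotzigRow i h t ≤ 2 * h
kotzigRow-≤ 0F h t≤ = t≤
kotzigRow-≤ 1F h t≤ = rotate-≤ h _ t≤
kotzigRow-≤ 2F h t≤ = kotzig-≤ h _ t≤

kotzigRow-injective : ∀ i h {a b} → a ≤ 2 * h → b ≤ 2 * h → kotzigRow i h a ≡ kotzigRow i h b → a ≡ b
kotzigRow-injective 0F h _ _ eq = eq
kotzigRow-injective 1F h = rotate-injective h
kotzigRow-injective 2F h = kotzig-injective h

permute-≤ : ∀ k h {t} → t ≤ 2 * h → permute k h t ≤ 2 * h
permute-≤ (i , false) h t≤ = kotzigRow-≤ i h t≤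
permute-≤ (i , true)  h {t} t≤ = mirror-≤ h (kotzigRow i h t)

permute-injective : ∀ k h {a b} → a ≤ 2 * h → b ≤ 2 * h → permute k h a ≡ permute k h b → a ≡ b
permute-injective (i , false) h a≤ b≤ eq = kotzigRow-injective i h a≤ b≤ eq
permute-injective (i , true)  h a≤ b≤ eq =
  kotzigRow-injective i h a≤ b≤ (mirror-injective h (kotzigRow-≤ i h a≤) (kotzigRow-≤ i h b≤) eq)

permute-column : ∀ b h {t} → t ≤ 2 * h → permute (0F , b) h t + permute (1F , b) h t + permute (2F , b) h t ≡ 3 * h
permute-column false h {t} t≤ = kotzig-column h t t≤
permute-column true  h {t} t≤ =
  mirror-column h t≤ (rotate-≤ h t t≤) (kotzig-≤ h t t≤) (kotzig-column h t t≤)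

permute-complement : ∀ i b h {t} → t ≤ 2 * h → permute (i , b) h t + permute (i , not b) h t ≡ 2 * h
permute-complement i false h t≤ = +-mirror h (kotzigRow-≤ i h t≤)
permute-complement i true  h t≤ = trans (+-comm _ (kotzigRow i h _)) (+-mirror h (kotzigRow-≤ i h t≤))

isOdd : ℕ → Bool
isOdd zero    = false
isOdd (suc n) = not (isOdd n)

next : Fin 3 → Fin 3
next 0F = 1F
next 1F = 2F
next 2F = 0F

-- Offsets on rung e and on its spokes to hubs 0 and 1 run through the three rows of a Kotzig array,
-- cyclically shifted for e < 3 and alternately mirrored for e ≥ 3; this keeps the sum constant
-- along every rung end and, over all rungs, at hubs 0 and 1.
tripleKind : ℕ → Fin 3 → Kind
tripleKind 0                   i = i , false
tripleKind 1                   i = next i , false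
tripleKind 2                   i = next (next i) , false
tripleKind (suc (suc (suc e))) i = i , isOdd e

-- On spokes to hubs j ≥ 2 the identity and its mirror image alternate, in opposite phase on the two
-- sides, so consecutive spokes at an end, and the two spokes of a rung at a hub, sum to 2h.
spokeOffsetKind : ℕ → Fin 2 → ℕ → Kind
spokeOffsetKind e sd 0             = tripleKind e 1F
spokeOffsetKind e sd 1             = tripleKind e 2F
spokeOffsetKind e 0F (suc (suc j)) = 0F , isOdd j
spokeOffsetKind e 1F (suc (suc j)) = 0F , not (isOdd j)

spokePositionKind : ℕ → Kind
spokePositionKind 0             = 0F , false
spokePositionKind 1             = 1F , false
spokePositionKind (suc (suc j)) = 0F , isOdd j

module _ (h : ℕ) {t : ℕ} (t≤ : t ≤ 2 * h) where

  private
    p : Kind → ℕ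
    p k = permute k h t

    column : ∀ b → p (0F , b) + p (1F , b) + p (2F , b) ≡ 3 * h
    column b = permute-column b h t≤

    rotated : ∀ x y z → x + y + z ≡ 3 * h → y + z + x ≡ 3 * h
    rotated x y z eq = trans (cycle x y z) eq
      where
      cycle : ∀ x y z → y + z + x ≡ x + y + z
      cycle = solve-∀

    alternating : ∀ i b → p (i , b) + p (i , not b) ≡ 2 * h
    alternating i b = permute-complement i b h t≤

    x y z : ℕ
    x = p (0F , false)
    y = p (1F , false)
    z = p (2F , false)

  tripleKind-row : ∀ e → p (tripleKind e 0F) + p (tripleKind e 1F) + p (tripleKind e 2F) ≡ 3 * h
  tripleKind-row 0                   = column false
  tripleKind-row 1                   = rotated x y z (column false)
  tripleKind-row 2                   = rotated y z x (rotated x y z (column false))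
  tripleKind-row (suc (suc (suc e))) = column (isOdd e)

  tripleKind-column : ∀ i → p (tripleKind 0 i) + p (tripleKind 1 i) + p (tripleKind 2 i) ≡ 3 * h
  tripleKind-column 0F = column false
  tripleKind-column 1F = rotated x y z (column false)
  tripleKind-column 2F = rotated y z x (rotated x y z (column false))

  private
    reassoc : ∀ a b c S → a + (b + (c + S)) ≡ a + b + c + S
    reassoc = solve-∀

    spoke-pairs : ∀ e sd m → sumBelow (m * 2) (λ j → p (spokeOffsetKind e sd (2 + j))) ≡ m * (2 * h)
    spoke-pairs e 0F m = sumBelow-pairs m (λ j → p (spokeOffsetKind e 0F (2 + j))) (λ j → alternating 0F (isOdd j))
    spoke-pairs e 1F m = sumBelow-pairs m (λ j → p (spokeOffsetKind e 1F (2 + j))) (λ j → alternating 0F (not (isOdd j)))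

  offset-row : ∀ e sd m → p (tripleKind e 0F) + sumBelow (2 + m * 2) (λ j → p (spokeOffsetKind e sd j)) ≡ 3 * h + m * (2 * h)
  offset-row e sd m = trans (reassoc (p (tripleKind e 0F)) (p (tripleKind e 1F)) (p (tripleKind e 2F)) _)
                            (cong₂ _+_ (tripleKind-row e) (spoke-pairs e sd m))

  position-row : ∀ m → kotzig h t + sumBelow (2 + m * 2) (λ j → p (spokePositionKind j)) ≡ 3 * h + m * (2 * h)
  position-row m = trans (rotateTerms z x y _)
    (cong₂ _+_ (column false) (sumBelow-pairs m (λ j → p (spokePositionKind (2 + j))) (λ j → alternating 0F (isOdd j))))
    where
    rotateTerms : ∀ z x y S → z + (x + (y + S)) ≡ x + y + z + S
    rotateTerms = solve-∀

  private
    doubled-triples : ∀ i m′ → sumBelow (3 + m′ * 2) (λ e → p (tripleKind e i) + p (tripleKind e i))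
                               ≡ 2 * (3 * h) + m′ * (2 * (2 * h))
    doubled-triples i m′ = trans (regroup (p (tripleKind 0 i)) (p (tripleKind 1 i)) (p (tripleKind 2 i)) _)
      (cong₂ _+_ (cong (2 *_) (tripleKind-column i))
      (sumBelow-pairs m′ (λ e → doubled (3 + e)) (λ e → trans (twice (p (i , isOdd e)) _) (cong (2 *_) (alternating i (isOdd e))))))
      where
      regroup : ∀ a b c S → (a + a) + ((b + b) + ((c + c) + S)) ≡ 2 * (a + b + c) + S
      regroup = solve-∀
      twice : ∀ a b → a + a + (b + b) ≡ 2 * (a + b)
      twice = solve-∀
      doubled : ℕ → ℕ
      doubled e = p (tripleKind e i) + p (tripleKind e i)

  offset-column : ∀ j m′ → sumBelow (3 + m′ * 2) (λ e → p (spokeOffsetKind e 0F j) + p (spokeOffsetKind e 1F j))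
                           ≡ 2 * (3 * h) + m′ * (2 * (2 * h))
  offset-column 0             m′ = doubled-triples 1F m′
  offset-column 1             m′ = doubled-triples 2F m′
  offset-column (suc (suc j)) m′ = begin
    sumBelow (3 + m′ * 2) (λ _ → p (0F , isOdd j) + p (0F , not (isOdd j)))
      ≡⟨ sum-cong-≗ {3 + m′ * 2} (λ _ → alternating 0F (isOdd j)) ⟩
    ∑[ _ < 3 + m′ * 2 ] (2 * h)                                               ≡⟨ ∑-const (3 + m′ * 2) (2 * h) ⟩
    (3 + m′ * 2) * (2 * h)                                                    ≡⟨ spread m′ h ⟩
    2 * (3 * h) + m′ * (2 * (2 * h))                                          ∎
    where
    open ≡-Reasoning
    spread : ∀ m h → (3 + m * 2) * (2 * h) ≡ 2 * (3 * h) + m * (2 * (2 * h))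
    spread = solve-∀

position-column : ∀ h j → sumBelow (suc (2 * h)) (λ e → permute (spokePositionKind j) h e) ≡ h * suc (2 * h)
position-column h 0             = sumBelow-odd h
position-column h 1             = trans (sumBelow-rotate h) (sumBelow-odd h)
position-column h (suc (suc j)) with isOdd j
... | false = sumBelow-odd h
... | true  = trans (sumBelow-mirror h) (sumBelow-odd h)

-- Block 0 holds the rungs; the spokes to hub j lie in block 1 + 2j (side 0) and 2N − 2j (side 1),
-- so the two blocks meeting at a hub sum to 2N + 1.
block : Fin 2 → ℕ → ℕ → ℕ
block 0F N j = 1 + 2 * j
block 1F N j = 2 + 2 * (N ∸ suc j)

block-row : ∀ sd N → sumBelow N (block sd N) ≡ N * (N + toℕ sd)
block-row 0F N = begin
  sumBelow N (λ j → 1 + 2 * j)  ≡⟨ sumBelow-affine N 1 2 id ⟩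
  N * 1 + 2 * sumBelow N id     ≡⟨ trans (cong₂ _+_ (*-identityʳ N) refl) (+-comm N _) ⟩
  2 * sumBelow N id + N         ≡⟨ gauss N ⟩
  N * N                         ≡⟨ cong (N *_) (+-identityʳ N) ⟨
  N * (N + 0)                   ∎
  where open ≡-Reasoning
block-row 1F N = begin
  sumBelow N (λ j → 2 + 2 * (N ∸ suc j))  ≡⟨ sumBelow-affine N 2 2 (λ j → N ∸ suc j) ⟩
  N * 2 + 2 * sumBelow N (λ j → N ∸ suc j) ≡⟨ cong (λ S → N * 2 + 2 * S) (sumBelow-reverse N) ⟩
  N * 2 + 2 * sumBelow N id                ≡⟨ regroup N (sumBelow N id) ⟩
  N + (2 * sumBelow N id + N)              ≡⟨ cong (N +_) (gauss N) ⟩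
  N + N * N                                ≡⟨ square N ⟩
  N * (N + 1)                              ∎
  where
  open ≡-Reasoning
  regroup : ∀ N S → N * 2 + 2 * S ≡ N + (2 * S + N)
  regroup = solve-∀
  square : ∀ N → N + N * N ≡ N * (N + 1)
  square = solve-∀

block-column : ∀ N j → j < N → block 0F N j + block 1F N j ≡ 1 + 2 * N
block-column N j j<N = begin
  1 + 2 * j + (2 + 2 * (N ∸ suc j))  ≡⟨ regroup j (N ∸ suc j) ⟩
  1 + 2 * (suc j + (N ∸ suc j))      ≡⟨ cong (λ x → 1 + 2 * x) (m+[n∸m]≡n j<N) ⟩
  1 + 2 * N                           ∎
  where
  open ≡-Reasoning
  regroup : ∀ j d → 1 + 2 * j + (2 + 2 * d) ≡ 1 + 2 * (suc j + d)
  regroup = solve-∀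

-- Vertex sums in disjoint unions, joins and copies

⌊≟⌋-injective : ∀ {m n} {f : Fin m → Fin n} → Injective _≡_ _≡_ f → ∀ a b → ⌊ f a ≟ᶠ f b ⌋ ≡ ⌊ a ≟ᶠ b ⌋
⌊≟⌋-injective {f = f} inj a b with a ≟ᶠ b
... | yes refl = trans (isYes≗does (f a ≟ᶠ f a)) (dec-true (f a ≟ᶠ f a) refl)
... | no  a≢b  = trans (isYes≗does (f a ≟ᶠ f b)) (dec-false (f a ≟ᶠ f b) (a≢b ∘ inj))

↑ˡ≢↑ʳ : ∀ {m n} (a : Fin m) (b : Fin n) → a ↑ˡ n ≢ m ↑ʳ b
↑ˡ≢↑ʳ {m} {n} a b eq = case trans (sym (splitAt-↑ˡ m a n)) (trans (cong (splitAt m) eq) (splitAt-↑ʳ m n b)) of λ ()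

⌊↑ˡ≟↑ʳ⌋ : ∀ {m n} (a : Fin m) (b : Fin n) → ⌊ a ↑ˡ n ≟ᶠ m ↑ʳ b ⌋ ≡ false
⌊↑ˡ≟↑ʳ⌋ {m} {n} a b = trans (isYes≗does (a ↑ˡ n ≟ᶠ m ↑ʳ b)) (dec-false (a ↑ˡ n ≟ᶠ m ↑ʳ b) (↑ˡ≢↑ʳ a b))

⌊↑ʳ≟↑ˡ⌋ : ∀ {m n} (a : Fin m) (b : Fin n) → ⌊ m ↑ʳ b ≟ᶠ a ↑ˡ n ⌋ ≡ false
⌊↑ʳ≟↑ˡ⌋ {m} {n} a b = trans (isYes≗does (m ↑ʳ b ≟ᶠ a ↑ˡ n)) (dec-false (m ↑ʳ b ≟ᶠ a ↑ˡ n) (↑ˡ≢↑ʳ a b ∘ sym))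

∑-indicator : ∀ n (u : Fin n) (g : Fin n → ℕ) → ∑[ i < n ] (if ⌊ i ≟ᶠ u ⌋ then g i else 0) ≡ g u
∑-indicator (suc n) zero    g = trans (cong (g zero +_) (sum-replicate-zero n)) (+-identityʳ (g zero))
∑-indicator (suc n) (suc u) g =
  trans (sum-cong-≗ {n} (λ i → cong (λ b → if b then g (suc i) else 0) (⌊≟⌋-injective sucᶠ-injective i u)))
        (∑-indicator n u (g ∘ suc))

incident : (G : Graph) → Fin (q G) → Fin (V G) → Bool
incident G e u = ⌊ proj₁ (ends G e) ≟ᶠ u ⌋ ∨ ⌊ proj₂ (ends G e) ≟ᶠ u ⌋

weight : (G : Graph) → (Fin (q G) → ℕ) → Fin (V G) → ℕ
weight G w u = ∑[ e < q G ] (if incident G e u then w e else 0)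

fplus≡weight : ∀ G f u → fplus G f u ≡ weight G (label f) u
fplus≡weight G f u = sumList-map-tabulate (q G) id
  where
  sumList-map-tabulate : ∀ n (g : Fin n → Fin (q G)) → sumList (map (λ e → if incident G e u then label f e else 0) (tabulate g))
                                                     ≡ ∑[ i < n ] (if incident G (g i) u then label f (g i) else 0)
  sumList-map-tabulate zero    g = refl
  sumList-map-tabulate (suc n) g = cong ((if incident G (g zero) u then label f (g zero) else 0) +_) (sumList-map-tabulate n (g ∘ suc))

∑-if-false : ∀ n {b : Fin n → Bool} (g : Fin n → ℕ) → (∀ i → b i ≡ false) → ∑[ i < n ] (if b i then g i else 0) ≡ 0
∑-if-false n g never = trans (sum-cong-≗ {n} (λ i → cong (λ b → if b then g i else 0) (never i))) (sum-replicate-zero n)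

∑-if-cong : ∀ n {b c : Fin n → Bool} (g : Fin n → ℕ) → (∀ i → b i ≡ c i) →
            ∑[ i < n ] (if b i then g i else 0) ≡ ∑[ i < n ] (if c i then g i else 0)
∑-if-cong n g b≗c = sum-cong-≗ {n} (λ i → cong (λ b → if b then g i else 0) (b≗c i))

module _ (G H : Graph) where

  ends-⊕ˡ : ∀ i → ends (G ⊕ H) (i ↑ˡ q H) ≡ (proj₁ (ends G i) ↑ˡ V H , proj₂ (ends G i) ↑ˡ V H)
  ends-⊕ˡ i rewrite splitAt-↑ˡ (q G) i (q H) = refl

  ends-⊕ʳ : ∀ i → ends (G ⊕ H) (q G ↑ʳ i) ≡ (V G ↑ʳ proj₁ (ends H i) , V G ↑ʳ proj₂ (ends H i))
  ends-⊕ʳ i rewrite splitAt-↑ʳ (q G) (q H) i = refl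

  weight-⊕ˡ : ∀ w u → weight (G ⊕ H) w (u ↑ˡ V H) ≡ weight G (w ∘ (_↑ˡ q H)) u
  weight-⊕ˡ w u = trans (∑-split (q G) (q H) _)
    (trans (cong₂ _+_ (∑-if-cong (q G) (w ∘ (_↑ˡ q H)) own) (∑-if-false (q H) (w ∘ (q G ↑ʳ_)) other)) (+-identityʳ _))
    where
    own : ∀ i → incident (G ⊕ H) (i ↑ˡ q H) (u ↑ˡ V H) ≡ incident G i u
    own i rewrite ends-⊕ˡ i
                | ⌊≟⌋-injective (λ {a} {b} → ↑ˡ-injective (V H) a b) (proj₁ (ends G i)) u
                | ⌊≟⌋-injective (λ {a} {b} → ↑ˡ-injective (V H) a b) (proj₂ (ends G i)) u = refl
    other : ∀ i → incident (G ⊕ H) (q G ↑ʳ i) (u ↑ˡ V H) ≡ false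
    other i rewrite ends-⊕ʳ i | ⌊↑ʳ≟↑ˡ⌋ u (proj₁ (ends H i)) | ⌊↑ʳ≟↑ˡ⌋ u (proj₂ (ends H i)) = refl

  weight-⊕ʳ : ∀ w u → weight (G ⊕ H) w (V G ↑ʳ u) ≡ weight H (w ∘ (q G ↑ʳ_)) u
  weight-⊕ʳ w u = trans (∑-split (q G) (q H) _)
    (cong₂ _+_ (∑-if-false (q G) (w ∘ (_↑ˡ q H)) other) (∑-if-cong (q H) (w ∘ (q G ↑ʳ_)) own))
    where
    own : ∀ i → incident (G ⊕ H) (q G ↑ʳ i) (V G ↑ʳ u) ≡ incident H i u
    own i rewrite ends-⊕ʳ i
                | ⌊≟⌋-injective (λ {a} {b} → ↑ʳ-injective (V G) a b) (proj₁ (ends H i)) u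
                | ⌊≟⌋-injective (λ {a} {b} → ↑ʳ-injective (V G) a b) (proj₂ (ends H i)) u = refl
    other : ∀ i → incident (G ⊕ H) (i ↑ˡ q H) (V G ↑ʳ u) ≡ false
    other i rewrite ends-⊕ˡ i | ⌊↑ˡ≟↑ʳ⌋ (proj₁ (ends G i)) u | ⌊↑ˡ≟↑ʳ⌋ (proj₂ (ends G i)) u = refl

∑-if-const : ∀ n c (g : Fin n → ℕ) → ∑[ i < n ] (if c then g i else 0) ≡ (if c then ∑[ i < n ] g i else 0)
∑-if-const n true  g = refl
∑-if-const n false g = sum-replicate-zero n

module _ (G H : Graph) where

  private
    joinEdge : Fin (V G) → Fin (V H) → Fin (q (G ∨G H))
    joinEdge a b = (q G + q H) ↑ʳ combine a b

  ends-∨-⊕ : ∀ i → ends (G ∨G H) (i ↑ˡ V G * V H) ≡ ends (G ⊕ H) i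
  ends-∨-⊕ i rewrite splitAt-↑ˡ (q G + q H) i (V G * V H) = refl

  ends-∨-spoke : ∀ a b → ends (G ∨G H) ((q G + q H) ↑ʳ combine a b) ≡ (a ↑ˡ V H , V G ↑ʳ b)
  ends-∨-spoke a b rewrite splitAt-↑ʳ (q G + q H) (V G * V H) (combine a b) =
    cong (λ p → (proj₁ p ↑ˡ V H , V G ↑ʳ proj₂ p)) (remQuot-combine a b)

  private
    weight-∨ : ∀ w u → weight (G ∨G H) w u ≡
      weight (G ⊕ H) (w ∘ (_↑ˡ V G * V H)) u +
      ∑[ a < V G ] ∑[ b < V H ] (if ⌊ a ↑ˡ V H ≟ᶠ u ⌋ ∨ ⌊ V G ↑ʳ b ≟ᶠ u ⌋ then w (joinEdge a b) else 0)
    weight-∨ w u = trans (∑-split (q G + q H) (V G * V H) _)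
      (cong₂ _+_ (∑-if-cong (q G + q H) (w ∘ (_↑ˡ V G * V H)) (λ i → cong (λ p → ⌊ proj₁ p ≟ᶠ u ⌋ ∨ ⌊ proj₂ p ≟ᶠ u ⌋) (ends-∨-⊕ i)))
                 (trans (∑-combine (V G) (V H) _)
                        (sum-cong-≗ {V G} λ a → ∑-if-cong (V H) (w ∘ joinEdge a) λ b →
                           cong (λ p → ⌊ proj₁ p ≟ᶠ u ⌋ ∨ ⌊ proj₂ p ≟ᶠ u ⌋) (ends-∨-spoke a b))))

  weight-∨ˡ : ∀ w u → weight (G ∨G H) w (u ↑ˡ V H) ≡
              weight G (λ i → w ((i ↑ˡ q H) ↑ˡ V G * V H)) u + ∑[ b < V H ] w (joinEdge u b)
  weight-∨ˡ w u = trans (weight-∨ w (u ↑ˡ V H)) (cong₂ _+_ (weight-⊕ˡ G H _ u) (begin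
    ∑[ a < V G ] ∑[ b < V H ] (if ⌊ a ↑ˡ V H ≟ᶠ u ↑ˡ V H ⌋ ∨ ⌊ V G ↑ʳ b ≟ᶠ u ↑ˡ V H ⌋ then w (joinEdge a b) else 0)
      ≡⟨ sum-cong-≗ {V G} (λ a → ∑-if-cong (V H) (w ∘ joinEdge a) (λ b → sameRow a b)) ⟩
    ∑[ a < V G ] ∑[ b < V H ] (if ⌊ a ≟ᶠ u ⌋ then w (joinEdge a b) else 0)
      ≡⟨ sum-cong-≗ {V G} (λ a → ∑-if-const (V H) ⌊ a ≟ᶠ u ⌋ (w ∘ joinEdge a)) ⟩
    ∑[ a < V G ] (if ⌊ a ≟ᶠ u ⌋ then ∑[ b < V H ] w (joinEdge a b) else 0)
      ≡⟨ ∑-indicator (V G) u (λ a → ∑[ b < V H ] w (joinEdge a b)) ⟩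
    ∑[ b < V H ] w (joinEdge u b) ∎))
    where
    open ≡-Reasoning
    sameRow : ∀ a b → (⌊ a ↑ˡ V H ≟ᶠ u ↑ˡ V H ⌋ ∨ ⌊ V G ↑ʳ b ≟ᶠ u ↑ˡ V H ⌋) ≡ ⌊ a ≟ᶠ u ⌋
    sameRow a b rewrite ⌊≟⌋-injective (λ {x} {y} → ↑ˡ-injective (V H) x y) a u | ⌊↑ʳ≟↑ˡ⌋ u b = ∨-identityʳ _

  weight-∨ʳ : ∀ w v → weight (G ∨G H) w (V G ↑ʳ v) ≡
              weight H (λ i → w ((q G ↑ʳ i) ↑ˡ V G * V H)) v + ∑[ a < V G ] w (joinEdge a v)
  weight-∨ʳ w v = trans (weight-∨ w (V G ↑ʳ v)) (cong₂ _+_ (weight-⊕ʳ G H _ v)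
    (sum-cong-≗ {V G} λ a → trans (∑-if-cong (V H) (w ∘ joinEdge a) (sameColumn a)) (∑-indicator (V H) v (w ∘ joinEdge a))))
    where
    sameColumn : ∀ a b → (⌊ a ↑ˡ V H ≟ᶠ V G ↑ʳ v ⌋ ∨ ⌊ V G ↑ʳ b ≟ᶠ V G ↑ʳ v ⌋) ≡ ⌊ b ≟ᶠ v ⌋
    sameColumn a b rewrite ⌊↑ˡ≟↑ʳ⌋ a v = ⌊≟⌋-injective (λ {x} {y} → ↑ʳ-injective (V G) x y) b v

module Copies (G : Graph) where

  copyV : ∀ {m} → Fin m → Fin (V G) → Fin (V (copies m G))
  copyV {suc m} zero    u = u ↑ˡ V (copies m G)
  copyV {suc m} (suc t) u = V G ↑ʳ copyV t u

  copyE : ∀ {m} → Fin m → Fin (q G) → Fin (q (copies m G))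
  copyE {suc m} zero    e = e ↑ˡ q (copies m G)
  copyE {suc m} (suc t) e = q G ↑ʳ copyE t e

  splitV : ∀ {m} → Fin (V (copies m G)) → Fin m × Fin (V G)
  splitV {suc m} x with splitAt (V G) x
  ... | inj₁ u = zero , u
  ... | inj₂ y = suc (proj₁ (splitV {m} y)) , proj₂ (splitV {m} y)

  splitE : ∀ {m} → Fin (q (copies m G)) → Fin m × Fin (q G)
  splitE {suc m} x with splitAt (q G) x
  ... | inj₁ e = zero , e
  ... | inj₂ y = suc (proj₁ (splitE {m} y)) , proj₂ (splitE {m} y)

  splitV-copyV : ∀ {m} (t : Fin m) u → splitV {m} (copyV t u) ≡ (t , u)
  splitV-copyV {suc m} zero    u rewrite splitAt-↑ˡ (V G) u (V (copies m G)) = refl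
  splitV-copyV {suc m} (suc t) u rewrite splitAt-↑ʳ (V G) (V (copies m G)) (copyV t u) | splitV-copyV t u = refl

  copyV-splitV : ∀ {m} x → copyV {m} (proj₁ (splitV {m} x)) (proj₂ (splitV {m} x)) ≡ x
  copyV-splitV {suc m} x with splitAt (V G) x in eq
  ... | inj₁ u = splitAt⁻¹-↑ˡ eq
  ... | inj₂ y = trans (cong (V G ↑ʳ_) (copyV-splitV {m} y)) (splitAt⁻¹-↑ʳ eq)

  splitE-copyE : ∀ {m} (t : Fin m) e → splitE {m} (copyE t e) ≡ (t , e)
  splitE-copyE {suc m} zero    e rewrite splitAt-↑ˡ (q G) e (q (copies m G)) = refl
  splitE-copyE {suc m} (suc t) e rewrite splitAt-↑ʳ (q G) (q (copies m G)) (copyE t e) | splitE-copyE t e = refl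

  copyE-splitE : ∀ {m} x → copyE {m} (proj₁ (splitE {m} x)) (proj₂ (splitE {m} x)) ≡ x
  copyE-splitE {suc m} x with splitAt (q G) x in eq
  ... | inj₁ e = splitAt⁻¹-↑ˡ eq
  ... | inj₂ y = trans (cong (q G ↑ʳ_) (copyE-splitE {m} y)) (splitAt⁻¹-↑ʳ eq)

  ends-copyE : ∀ {m} (t : Fin m) e → ends (copies m G) (copyE t e) ≡ (copyV t (proj₁ (ends G e)) , copyV t (proj₂ (ends G e)))
  ends-copyE {suc m} zero    e = ends-⊕ˡ G (copies m G) e
  ends-copyE {suc m} (suc t) e = trans (ends-⊕ʳ G (copies m G) (copyE t e))
                                       (cong (λ p → V G ↑ʳ proj₁ p , V G ↑ʳ proj₂ p) (ends-copyE t e))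

  weight-copyV : ∀ {m} w (t : Fin m) u → weight (copies m G) w (copyV t u) ≡ weight G (w ∘ copyE t) u
  weight-copyV {suc m} w zero    u = weight-⊕ˡ G (copies m G) w u
  weight-copyV {suc m} w (suc t) u = trans (weight-⊕ʳ G (copies m G) w (copyV t u)) (weight-copyV _ t u)

  ∑-copyV : ∀ m (g : Fin (V (copies m G)) → ℕ) → ∑[ x < V (copies m G) ] g x ≡ ∑[ t < m ] ∑[ u < V G ] g (copyV t u)
  ∑-copyV zero    g = refl
  ∑-copyV (suc m) g = trans (∑-split (V G) (V (copies m G)) g) (cong (∑[ u < V G ] g (u ↑ˡ V (copies m G)) +_) (∑-copyV m _))

q-copies : ∀ m G → q (copies m G) ≡ m * q G
q-copies zero    G = refl
q-copies (suc m) G = cong (q G +_) (q-copies m G)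

V-copies : ∀ m G → V (copies m G) ≡ m * V G
V-copies zero    G = refl
V-copies (suc m) G = cong (V G +_) (V-copies m G)

-- Counting colours

∈⇒≡-lookup : ∀ {x : ℕ} {ys} (x∈ys : x ∈ ys) → x ≡ lookup ys (index x∈ys)
∈⇒≡-lookup (here refl) = refl
∈⇒≡-lookup (there x∈ys) = ∈⇒≡-lookup x∈ys

unique-lookup-injective : ∀ {xs : List ℕ} → Unique xs → Injective _≡_ _≡_ (lookup xs)
unique-lookup-injective {xs = _ ∷ _} (_    ∷ _)      {Fin.zero}  {Fin.zero}  _  = refl
unique-lookup-injective {xs = _ ∷ _} (x∉ys ∷ _)      {Fin.zero}  {Fin.suc j} eq = contradiction eq (All.lookup x∉ys (∈-lookup j))
unique-lookup-injective {xs = _ ∷ _} (x∉ys ∷ _)      {Fin.suc i} {Fin.zero}  eq = contradiction (sym eq) (All.lookup x∉ys (∈-lookup i))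
unique-lookup-injective {xs = _ ∷ _} (_    ∷ unique) {Fin.suc i} {Fin.suc j} eq = cong Fin.suc (unique-lookup-injective unique eq)

unique-⊆⇒length≤ : ∀ {xs ys : List ℕ} → Unique xs → (∀ {x} → x ∈ xs → x ∈ ys) → length xs ≤ length ys
unique-⊆⇒length≤ {xs} {ys} unique xs⊆ys = injective⇒≤ position-injective
  where
  position : Fin (length xs) → Fin (length ys)
  position i = index (xs⊆ys (∈-lookup i))
  position-injective : Injective _≡_ _≡_ position
  position-injective {i} {j} eq = unique-lookup-injective unique
    (trans (∈⇒≡-lookup (xs⊆ys (∈-lookup i))) (trans (cong (lookup ys) eq) (sym (∈⇒≡-lookup (xs⊆ys (∈-lookup j))))))

module _ (G : Graph) (f : Fin (q G) → Fin (q G)) where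

  colours : List ℕ
  colours = deduplicate _≟_ (map (fplus G f) (allFin (V G)))

  colour∈colours : ∀ u → fplus G f u ∈ colours
  colour∈colours u = ∈-deduplicate⁺ _≟_ (∈-map⁺ (fplus G f) (∈-allFin u))

  numColours≤ : ∀ {cs} → (∀ u → fplus G f u ∈ cs) → numColours G f ≤ length cs
  numColours≤ {cs} covered = unique-⊆⇒length≤ (deduplicate-! _≟_ sums) λ c∈ →
    let (u , _ , c≡) = ∈-map⁻ (fplus G f) (∈-deduplicate⁻ _≟_ sums c∈) in subst (_∈ cs) (sym c≡) (covered u)
    where
    sums : List ℕ
    sums = map (fplus G f) (allFin (V G))

  3≤numColours : ∀ {u v w} → fplus G f u ≢ fplus G f v → fplus G f u ≢ fplus G f w → fplus G f v ≢ fplus G f w →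
                 3 ≤ numColours G f
  3≤numColours {u} {v} {w} u≢v u≢w v≢w =
    unique-⊆⇒length≤ ((u≢v ∷ u≢w ∷ []) ∷ (v≢w ∷ []) ∷ [] ∷ [])
      λ { (here refl)                 → colour∈colours u
        ; (there (here refl))         → colour∈colours v
        ; (there (there (here refl))) → colour∈colours w }

separated : ∀ G f → IsLocalAntimagic G f → ∀ {e x y} → ends G e ≡ (x , y) → fplus G f x ≢ fplus G f y
separated G f (_ , separates) {e} eq = subst (λ p → fplus G f (proj₁ p) ≢ fplus G f (proj₂ p)) eq (separates e)

endpoint-colours-differ : ∀ G f {e x y a b} → ends G e ≡ (x , y) → fplus G f x ≡ a → fplus G f y ≡ b → a ≢ b →
                          fplus G f (proj₁ (ends G e)) ≢ fplus G f (proj₂ (ends G e))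
endpoint-colours-differ G f ends≡ x≡a y≡b a≢b =
  subst (λ p → fplus G f (proj₁ p) ≢ fplus G f (proj₂ p)) (sym ends≡) (λ same → a≢b (trans (sym x≡a) (trans same y≡b)))

-- The graph R[K P₂ ∨ O_N]

module Structure (R K N : ℕ) where

  open Copies

  Matching : Graph
  Matching = copies K P₂

  Join : Graph
  Join = Matching ∨G O N

  Γ : Graph
  Γ = copies R Join

  data Slot : Set where
    rung  : Slot
    spoke : Fin 2 → Fin N → Slot

  Edge : Set
  Edge = Fin R × Fin K × Slot

  slotEdge : Fin K → Slot → Fin (q Join)
  slotEdge e rung         = (copyE P₂ e zero ↑ˡ 0) ↑ˡ V Matching * N
  slotEdge e (spoke sd j) = (q Matching + 0) ↑ʳ combine (copyV P₂ e sd) j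

  encode : Edge → Fin (q Γ)
  encode (t , e , σ) = copyE Join t (slotEdge e σ)

  end : Fin R → Fin K → Fin 2 → Fin (V Γ)
  end t e sd = copyV Join t (copyV P₂ e sd ↑ˡ N)

  hub : Fin R → Fin N → Fin (V Γ)
  hub t j = copyV Join t (V Matching ↑ʳ j)

  ends-rung : ∀ t e → ends Γ (encode (t , e , rung)) ≡ (end t e 0F , end t e 1F)
  ends-rung t e = trans (ends-copyE Join t _) (cong (λ p → copyV Join t (proj₁ p) , copyV Join t (proj₂ p))
    (trans (ends-∨-⊕ Matching (O N) _) (trans (ends-⊕ˡ Matching (O N) _)
      (cong (λ p → proj₁ p ↑ˡ N , proj₂ p ↑ˡ N) (ends-copyE P₂ e zero)))))

  ends-spoke : ∀ t e sd j → ends Γ (encode (t , e , spoke sd j)) ≡ (end t e sd , hub t j)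
  ends-spoke t e sd j = trans (ends-copyE Join t _)
    (cong (λ p → copyV Join t (proj₁ p) , copyV Join t (proj₂ p)) (ends-∨-spoke Matching (O N) (copyV P₂ e sd) j))

  weight-end : ∀ w t e sd → weight Γ w (end t e sd) ≡ w (encode (t , e , rung)) + ∑[ j < N ] w (encode (t , e , spoke sd j))
  weight-end w t e sd =
    trans (weight-copyV Join w t _) (trans (weight-∨ˡ Matching (O N) _ (copyV P₂ e sd))
      (cong (_+ ∑[ j < N ] w (encode (t , e , spoke sd j))) (trans (weight-copyV P₂ _ e sd) (rungWeight sd))))
    where
    rungWeight : ∀ sd → weight P₂ (λ i → w (encode (t , e , rung))) sd ≡ w (encode (t , e , rung))
    rungWeight 0F = +-identityʳ _
    rungWeight 1F = +-identityʳ _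

  weight-hub : ∀ w t j → weight Γ w (hub t j) ≡
               ∑[ e < K ] (w (encode (t , e , spoke 0F j)) + (w (encode (t , e , spoke 1F j)) + 0))
  weight-hub w t j = trans (weight-copyV Join w t _) (trans (weight-∨ʳ Matching (O N) _ j) (∑-copyV P₂ K _))

  data Vertex : Fin (V Γ) → Set where
    isEnd : ∀ t e sd → Vertex (end t e sd)
    isHub : ∀ t j → Vertex (hub t j)

  vertex : ∀ x → Vertex x
  vertex x = subst Vertex (copyV-splitV Join {R} x) (inCopy (proj₁ (splitV Join {R} x)) (proj₂ (splitV Join {R} x)))
    where
    inCopy : ∀ t y → Vertex (copyV Join t y)
    inCopy t y with splitAt (V Matching) y in eq
    ... | inj₁ u = subst (λ z → Vertex (copyV Join t z))
                         (trans (cong (_↑ˡ N) (copyV-splitV P₂ {K} u)) (splitAt⁻¹-↑ˡ eq))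
                         (isEnd t (proj₁ (splitV P₂ {K} u)) (proj₂ (splitV P₂ {K} u)))
    ... | inj₂ j = subst (λ z → Vertex (copyV Join t z)) (splitAt⁻¹-↑ʳ eq) (isHub t j)

  private
    spokeAt : Fin (V Matching) × Fin N → Fin K × Slot
    spokeAt (u , j) = proj₁ (splitV P₂ {K} u) , spoke (proj₂ (splitV P₂ {K} u)) j

    splitSlot : Fin (q Join) → Fin K × Slot
    splitSlot x with splitAt (q Matching + 0) x
    ... | inj₂ y = spokeAt (remQuot N y)
    ... | inj₁ y with splitAt (q Matching) y
    ...   | inj₁ z = proj₁ (splitE P₂ {K} z) , rung

    splitSlot-slotEdge : ∀ e σ → splitSlot (slotEdge e σ) ≡ (e , σ)
    splitSlot-slotEdge e rung
      rewrite splitAt-↑ˡ (q Matching + 0) (copyE P₂ e zero ↑ˡ 0) (V Matching * N)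
            | splitAt-↑ˡ (q Matching) (copyE P₂ e zero) 0
            | splitE-copyE P₂ e zero = refl
    splitSlot-slotEdge e (spoke sd j)
      rewrite splitAt-↑ʳ (q Matching + 0) (V Matching * N) (combine (copyV P₂ e sd) j) =
      trans (cong spokeAt (remQuot-combine (copyV P₂ e sd) j)) (cong (λ p → proj₁ p , spoke (proj₂ p) j) (splitV-copyV P₂ e sd))

    slotEdge-splitSlot : ∀ x → slotEdge (proj₁ (splitSlot x)) (proj₂ (splitSlot x)) ≡ x
    slotEdge-splitSlot x with splitAt (q Matching + 0) x in eq
    ... | inj₂ y = trans (spokeEdge (remQuot N y))
                         (trans (cong ((q Matching + 0) ↑ʳ_) (combine-remQuot {V Matching} N y)) (splitAt⁻¹-↑ʳ eq))
      where
      spokeEdge : ∀ p → slotEdge (proj₁ (spokeAt p)) (proj₂ (spokeAt p)) ≡ (q Matching + 0) ↑ʳ combine (proj₁ p) (proj₂ p)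
      spokeEdge (u , j) = cong (λ v → (q Matching + 0) ↑ʳ combine v j) (copyV-splitV P₂ {K} u)
    ... | inj₁ y with splitAt (q Matching) y in eq′
    ...   | inj₁ z = trans (cong (_↑ˡ V Matching * N) (trans (cong (_↑ˡ 0) rungEdge) (splitAt⁻¹-↑ˡ eq′))) (splitAt⁻¹-↑ˡ eq)
      where
      rungEdge : copyE P₂ (proj₁ (splitE P₂ {K} z)) zero ≡ z
      rungEdge = trans (cong (copyE P₂ (proj₁ (splitE P₂ {K} z))) (onlyEdge (proj₂ (splitE P₂ {K} z)))) (copyE-splitE P₂ {K} z)
        where
        onlyEdge : (i : Fin 1) → zero ≡ i
        onlyEdge zero = refl

  decode : Fin (q Γ) → Edge
  decode x = proj₁ (splitE Join {R} x) , splitSlot (proj₂ (splitE Join {R} x))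

  decode-encode : ∀ p → decode (encode p) ≡ p
  decode-encode (t , e , σ) rewrite splitE-copyE Join t (slotEdge e σ) | splitSlot-slotEdge e σ = refl

  encode-decode : ∀ x → encode (decode x) ≡ x
  encode-decode x = trans (cong (copyE Join (proj₁ (splitE Join {R} x))) (slotEdge-splitSlot (proj₂ (splitE Join {R} x))))
                          (copyE-splitE Join {R} x)

-- The labelling

module Values (r s n : ℕ) where

  R K N : ℕ
  R = 2 * r + 1
  K = 2 * s + 1
  N = 2 * n

  -- The vertex sums of the labelling below at the ends of side d and at the hubs.
  endValue : ℕ → ℕ
  endValue d = (1 + r) * (N + 1) + R * (s * (N + 1) + K * (N * (N + d)))

  hubValue : ℕ
  hubValue = (1 + r) * (2 * K) + R * (K * (2 * s + K * (2 * N + 1)))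

  private
    instance
      R≢0 : NonZero R
      R≢0 = >-nonZero (0<odd r)
      K≢0 : NonZero K
      K≢0 = >-nonZero (0<odd s)

  end₀<end₁ : 0 < n → endValue 0 < endValue 1
  end₀<end₁ 0<n = +-monoʳ-< ((1 + r) * (N + 1)) (*-monoʳ-< R (+-monoʳ-< (s * (N + 1)) (*-monoʳ-< K
    (*-monoʳ-< N ⦃ >-nonZero (*-monoʳ-< 2 0<n) ⦄ (subst (_< N + 1) (sym (+-identityʳ N)) (m<m+n N z<s))))))

  end₁<hub : n < K → endValue 1 < hubValue
  end₁<hub n<K = +-mono-<-≤ (*-monoʳ-< (1 + r) N+1<2K) (*-monoʳ-≤ R (begin
    s * (N + 1) + K * (N * (N + 1))      ≤⟨ +-mono-≤ (*-monoʳ-≤ s (<⇒≤ N+1<2K)) (*-monoʳ-≤ K (*-monoʳ-≤ N (<⇒≤ N+1<2K))) ⟩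
    s * (2 * K) + K * (N * (2 * K))      ≡⟨ regroup s K N ⟩
    K * (2 * s) + K * (K * (2 * N))      ≤⟨ +-monoʳ-≤ (K * (2 * s)) (*-monoʳ-≤ K (*-monoʳ-≤ K (m≤m+n (2 * N) 1))) ⟩
    K * (2 * s) + K * (K * (2 * N + 1))  ≡⟨ *-distribˡ-+ K (2 * s) _ ⟨
    K * (2 * s + K * (2 * N + 1))        ∎))
    where
    open ≤-Reasoning
    N+1<2K : N + 1 < 2 * K
    N+1<2K = subst (_≤ 2 * K) (double n) (*-monoʳ-≤ 2 n<K)
      where
      double : ∀ n → 2 * suc n ≡ suc (2 * n + 1)
      double = solve-∀
    regroup : ∀ s K N → s * (2 * K) + K * (N * (2 * K)) ≡ K * (2 * s) + K * (K * (2 * N))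
    regroup = solve-∀

  hub<end₀ : K < n → hubValue < endValue 0
  hub<end₀ K<n = +-mono-<-≤ (*-monoʳ-< (1 + r) 2K<N+1)
                            (*-monoʳ-≤ R (begin
    K * (2 * s + K * (2 * N + 1))   ≤⟨ *-monoʳ-≤ K (begin
      2 * s + K * (2 * N + 1)         ≡⟨ regroup s K N ⟩
      (2 * s + K) + N * (2 * K)       ≤⟨ +-monoˡ-≤ (N * (2 * K)) (≤-trans 2s+K≤2K+2 2K+2≤N) ⟩
      N + N * (2 * K)                 ≡⟨ *-suc N (2 * K) ⟨
      N * suc (2 * K)                 ≤⟨ *-monoʳ-≤ N (≤-trans (n≤1+n (suc (2 * K))) (subst (_≤ N) (+-comm (2 * K) 2) 2K+2≤N)) ⟩
      N * N                           ≡⟨ cong (N *_) (+-identityʳ N) ⟨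
      N * (N + 0)                     ∎) ⟩
    K * (N * (N + 0))               ≤⟨ m≤n+m (K * (N * (N + 0))) (s * (N + 1)) ⟩
    s * (N + 1) + K * (N * (N + 0)) ∎))
    where
    open ≤-Reasoning
    2K+2≤N : 2 * K + 2 ≤ N
    2K+2≤N = subst (_≤ N) (double K) (*-monoʳ-≤ 2 K<n)
      where
      double : ∀ K → 2 * suc K ≡ 2 * K + 2
      double = solve-∀
    2K<N+1 : 2 * K < N + 1
    2K<N+1 = ≤-trans (m+k≡n⇒m≤n 1 (trans (+-comm (suc (2 * K)) 1) (+-comm 2 (2 * K)))) (≤-trans 2K+2≤N (m≤m+n N 1))
    2s+K≤2K+2 : 2 * s + K ≤ 2 * K + 2
    2s+K≤2K+2 = m+k≡n⇒m≤n 3 (slack s)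
      where
      slack : ∀ s → 2 * s + (2 * s + 1) + 3 ≡ 2 * (2 * s + 1) + 2
      slack = solve-∀
    regroup : ∀ s K N → 2 * s + K * (2 * N + 1) ≡ (2 * s + K) + N * (2 * K)
    regroup = solve-∀

  hub<end₁ : n ≡ K → hubValue < endValue 1
  hub<end₁ refl = +-mono-<-≤ (*-monoʳ-< (1 + r) (m<m+n (2 * K) z<s)) (*-monoʳ-≤ R (begin
    K * (2 * s + K * (2 * N + 1))        ≡⟨ regroup s K N ⟩
    s * (2 * K) + K * (K * (2 * N + 1))  ≤⟨ +-mono-≤ (*-monoʳ-≤ s (m≤m+n (2 * K) 1)) (*-monoʳ-≤ K (begin
      K * (2 * N + 1)                      ≡⟨ spread K ⟩
      N * N + K                            ≤⟨ +-monoʳ-≤ (N * N) (m≤m+n K (K + 0)) ⟩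
      N * N + N                            ≡⟨ +-comm (N * N) N ⟩
      N + N * N                            ≡⟨ *-suc N N ⟨
      N * suc N                            ≡⟨ cong (N *_) (+-comm 1 N) ⟩
      N * (N + 1)                          ∎)) ⟩
    s * (2 * K + 1) + K * (N * (N + 1))  ∎))
    where
    open ≤-Reasoning
    regroup : ∀ s K N → K * (2 * s + K * (2 * N + 1)) ≡ s * (2 * K) + K * (K * (2 * N + 1))
    regroup = solve-∀
    spread : ∀ K → K * (2 * (2 * K) + 1) ≡ 2 * K * (2 * K) + K
    spread = solve-∀

  end₀<hub : n ≡ K → 0 < s → endValue 0 < hubValue
  end₀<hub refl 0<s = subst (_< hubValue) (sym (regroup (1 + r) (R * e₀) K)) (+-monoʳ-< ((1 + r) * (2 * K)) (begin-strict
    (1 + r) + R * e₀  ≤⟨ +-monoˡ-≤ (R * e₀) (1+r≤R r) ⟩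
    R + R * e₀        ≡⟨ *-suc R e₀ ⟨
    R * suc e₀        <⟨ *-monoʳ-< R e₀+2≤h ⟩
    R * h             ∎))
    where
    open ≤-Reasoning
    e₀ h : ℕ
    e₀ = s * (N + 1) + K * (N * (N + 0))
    h = K * (2 * s + K * (2 * N + 1))
    regroup : ∀ a b K → a * (2 * K + 1) + b ≡ a * (2 * K) + (a + b)
    regroup = solve-∀
    1+r≤R : ∀ r → 1 + r ≤ 2 * r + 1
    1+r≤R r = m+k≡n⇒m≤n r (solve-1+r r)
      where
      solve-1+r : ∀ r → 1 + r + r ≡ 2 * r + 1
      solve-1+r = solve-∀
    rearrange : ∀ e s → suc (suc e) + s ≡ e + (s + 2)
    rearrange = solve-∀
    excess : ∀ s K → K * (2 * s + K * (2 * (2 * K) + 1)) + s ≡ s * (2 * K + 1) + K * (2 * K * (2 * K + 0)) + K * K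
    excess = solve-∀
    s+2≤K : s + 2 ≤ K
    s+2≤K = subst₂ _≤_ (shift s) (double s) (+-monoˡ-≤ 1 (+-monoˡ-≤ s 0<s))
      where
      shift : ∀ s → 1 + s + 1 ≡ s + 2
      shift = solve-∀
      double : ∀ s → s + s + 1 ≡ 2 * s + 1
      double = solve-∀
    e₀+2≤h : suc e₀ < h
    e₀+2≤h = +-cancelʳ-≤ s (suc (suc e₀)) h (begin
      suc (suc e₀) + s   ≡⟨ rearrange e₀ s ⟩
      e₀ + (s + 2)       ≤⟨ +-monoʳ-≤ e₀ (≤-trans s+2≤K (m≤m*n K K)) ⟩
      e₀ + K * K         ≡⟨ excess s K ⟨
      h + s              ∎)

  values-distinct : 0 < n → 0 < s → endValue 0 ≢ endValue 1 × endValue 0 ≢ hubValue × endValue 1 ≢ hubValue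
  values-distinct 0<n 0<s with end₀<end₁ 0<n | <-cmp n K
  ... | e₀<e₁ | tri< n<K _ _ = <⇒≢ e₀<e₁ , <⇒≢ (<-trans e₀<e₁ (end₁<hub n<K)) , <⇒≢ (end₁<hub n<K)
  ... | e₀<e₁ | tri≈ _ n≡K _ = <⇒≢ e₀<e₁ , <⇒≢ (end₀<hub n≡K 0<s) , >⇒≢ (hub<end₁ n≡K)
  ... | e₀<e₁ | tri> _ _ K<n = <⇒≢ e₀<e₁ , >⇒≢ (hub<end₀ K<n) , >⇒≢ (<-trans (hub<end₀ K<n) e₀<e₁)

module Labelling (r s n : ℕ) where

  open Values r s n public
  open Structure R K N public

  offsetKind : Fin K → Slot → Kind
  offsetKind e rung         = tripleKind (toℕ e) 0F
  offsetKind e (spoke sd j) = spokeOffsetKind (toℕ e) sd (toℕ j)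

  positionKind : Slot → Kind
  positionKind rung         = 2F , false
  positionKind (spoke sd j) = spokePositionKind (toℕ j)

  blockOf : Slot → ℕ
  blockOf rung         = 0
  blockOf (spoke sd j) = block sd N (toℕ j)

  offset : Fin R → Fin K → Slot → ℕ
  offset t e σ = permute (offsetKind e σ) r (toℕ t)

  position : Fin K → Slot → ℕ
  position e σ = permute (positionKind σ) s (toℕ e)

  value : Edge → ℕ
  value (t , e , σ) = offset t e σ + R * (position e σ + K * blockOf σ)

  offset-< : ∀ t e σ → offset t e σ < R
  offset-< t e σ = subst (offset t e σ <_) (+-comm 1 (2 * r)) (s≤s (permute-≤ (offsetKind e σ) r (toℕ≤pred[2h+1] r t)))

  position-< : ∀ e σ → position e σ < K
  position-< e σ = subst (position e σ <_) (+-comm 1 (2 * s)) (s≤s (permute-≤ (positionKind σ) s (toℕ≤pred[2h+1] s e)))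

  blockOf-< : ∀ σ → blockOf σ < suc (2 * N)
  blockOf-< rung = s≤s z≤n
  blockOf-< (spoke 0F j) = subst (block 0F N (toℕ j) <_) (block-column N (toℕ j) (toℕ<n j))
                                 (m<m+n (block 0F N (toℕ j)) (s≤s z≤n))
  blockOf-< (spoke 1F j) = subst (block 1F N (toℕ j) <_) (block-column N (toℕ j) (toℕ<n j))
                                 (m<n+m (block 1F N (toℕ j)) (s≤s z≤n))

  blockOf-injective : ∀ σ σ′ → blockOf σ ≡ blockOf σ′ → σ ≡ σ′
  blockOf-injective rung          rung           _  = refl
  blockOf-injective (spoke 0F j)  (spoke 0F j′)  eq =
    cong (spoke 0F) (toℕ-injective (*-cancelˡ-≡ (toℕ j) (toℕ j′) 2 (suc-injective eq)))
  blockOf-injective (spoke 1F j)  (spoke 1F j′)  eq = cong (spoke 1F) (toℕ-injective (suc-injective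
    (∸-cancelˡ-≡ (toℕ<n j) (toℕ<n j′)
      (*-cancelˡ-≡ (N ∸ suc (toℕ j)) (N ∸ suc (toℕ j′)) 2 (suc-injective (suc-injective eq))))))
  blockOf-injective (spoke 0F j)  (spoke 1F j′)  eq = contradiction (trans (*-suc 2 x) (sym eq)) (even≢odd (suc x) (toℕ j))
    where x = N ∸ suc (toℕ j′)
  blockOf-injective (spoke 1F j)  (spoke 0F j′)  eq = contradiction (trans (*-suc 2 x) eq) (even≢odd (suc x) (toℕ j′))
    where x = N ∸ suc (toℕ j)
  blockOf-injective rung          (spoke 0F _)   ()
  blockOf-injective rung          (spoke 1F _)   ()
  blockOf-injective (spoke 0F _)  rung           ()
  blockOf-injective (spoke 1F _)  rung           ()

  q-Γ : q Γ ≡ R * (K * suc (2 * N))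
  q-Γ = trans (q-copies R Join)
              (cong (R *_) (trans (cong₂ (λ a b → a + 0 + b * N) (q-copies K P₂) (V-copies K P₂)) (count K N)))
    where
    count : ∀ K N → K * 1 + 0 + K * 2 * N ≡ K * suc (2 * N)
    count = solve-∀

  value-< : ∀ p → value p < q Γ
  value-< (t , e , σ) = subst (value (t , e , σ) <_) (sym q-Γ)
    (+-*-< (offset-< t e σ) (+-*-< (position-< e σ) (blockOf-< σ)))

  value-injective : ∀ p p′ → value p ≡ value p′ → p ≡ p′
  value-injective (t , e , σ) (t′ , e′ , σ′) eq with +-*-injective (offset-< t e σ) (offset-< t′ e′ σ′) eq
  ... | offset≡ , base≡ with +-*-injective (position-< e σ) (position-< e′ σ′) base≡
  ... | position≡ , block≡ with blockOf-injective σ σ′ block≡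
  ... | refl with toℕ-injective (permute-injective (positionKind σ) s (toℕ≤pred[2h+1] s e) (toℕ≤pred[2h+1] s e′) position≡)
  ... | refl = cong (_, e , σ)
    (toℕ-injective (permute-injective (offsetKind e σ) r (toℕ≤pred[2h+1] r t) (toℕ≤pred[2h+1] r t′) offset≡))

  labelling : Fin (q Γ) → Fin (q Γ)
  labelling x = fromℕ< (value-< (decode x))

  labelling-injective : Injective _≡_ _≡_ labelling
  labelling-injective {x} {y} eq = begin
    x                    ≡⟨ encode-decode x ⟨
    encode (decode x)    ≡⟨ cong encode (value-injective (decode x) (decode y) values≡) ⟩
    encode (decode y)    ≡⟨ encode-decode y ⟩
    y                    ∎
    where
    open ≡-Reasoning
    values≡ : value (decode x) ≡ value (decode y)
    values≡ = trans (sym (toℕ-fromℕ< (value-< (decode x)))) (trans (cong toℕ eq) (toℕ-fromℕ< (value-< (decode y))))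

  labelling-bijective : Bijective _≡_ _≡_ labelling
  labelling-bijective = labelling-injective , injective⇒surjective labelling labelling-injective

  label-encode : ∀ p → label labelling (encode p) ≡ suc (value p)
  label-encode p = cong suc (trans (toℕ-fromℕ< (value-< (decode (encode p)))) (cong value (decode-encode p)))

sumBelow-labels : ∀ m R K (o p b : ℕ → ℕ) →
  sumBelow m (λ j → suc (o j + R * (p j + K * b j))) ≡ m + sumBelow m o + R * (sumBelow m p + K * sumBelow m b)
sumBelow-labels zero    R K o p b = sym (base R K)
  where
  base : ∀ R K → R * (0 + K * 0) ≡ 0
  base = solve-∀
sumBelow-labels (suc m) R K o p b =
  trans (cong (suc (o 0 + R * (p 0 + K * b 0)) +_) (sumBelow-labels m R K (λ j → o (suc j)) (λ j → p (suc j)) (λ j → b (suc j))))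
        (step (o 0) (p 0) (b 0) m (sumBelow m (λ j → o (suc j))) (sumBelow m (λ j → p (suc j))) (sumBelow m (λ j → b (suc j))) R K)
  where
  step : ∀ o p b m O P B R K → suc (o + R * (p + K * b)) + (m + O + R * (P + K * B)) ≡ suc m + (o + O) + R * ((p + P) + K * (b + B))
  step = solve-∀

sumBelow-label-pairs : ∀ m R K (o o′ p : ℕ → ℕ) b b′ →
  sumBelow m (λ e → suc (o e + R * (p e + K * b)) + (suc (o′ e + R * (p e + K * b′)) + 0))
    ≡ m * 2 + sumBelow m (λ e → o e + o′ e) + R * (2 * sumBelow m p + K * (m * (b + b′)))
sumBelow-label-pairs zero    R K o o′ p b b′ = sym (base R K (b + b′))
  where
  base : ∀ R K c → R * (2 * 0 + K * (0 * c)) ≡ 0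
  base = solve-∀
sumBelow-label-pairs (suc m) R K o o′ p b b′ =
  trans (cong (suc (o 0 + R * (p 0 + K * b)) + (suc (o′ 0 + R * (p 0 + K * b′)) + 0) +_)
              (sumBelow-label-pairs m R K (λ e → o (suc e)) (λ e → o′ (suc e)) (λ e → p (suc e)) b b′))
        (step (o 0) (o′ 0) (p 0) b b′ m (sumBelow m (λ e → o (suc e) + o′ (suc e))) (sumBelow m (λ e → p (suc e))) R K)
  where
  step : ∀ o o′ p b b′ m O P R K →
         suc (o + R * (p + K * b)) + (suc (o′ + R * (p + K * b′)) + 0) + (m * 2 + O + R * (2 * P + K * (m * (b + b′))))
         ≡ suc m * 2 + ((o + o′) + O) + R * (2 * (p + P) + K * (suc m * (b + b′)))
  step = solve-∀

module VertexSums (r s₁ n₁ : ℕ) where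

  s n : ℕ
  s = suc s₁
  n = suc n₁

  open Labelling r s n public

  private
    N≡2+n₁*2 : N ≡ 2 + n₁ * 2
    N≡2+n₁*2 = double n₁
      where
      double : ∀ n → 2 * suc n ≡ 2 + n * 2
      double = solve-∀

  end-weight≡endValue : ∀ t e sd → weight Γ (label labelling) (end t e sd) ≡ endValue (toℕ sd)
  end-weight≡endValue t e sd = begin
    weight Γ (label labelling) (end t e sd)
      ≡⟨ weight-end (label labelling) t e sd ⟩
    label labelling (encode (t , e , rung)) + ∑[ j < N ] label labelling (encode (t , e , spoke sd j))
      ≡⟨ cong₂ _+_ (label-encode (t , e , rung)) (sum-cong-≗ {N} (λ j → label-encode (t , e , spoke sd j))) ⟩
    suc (o₀ + R * (p₀ + K * 0)) + sumBelow N (λ j → suc (o j + R * (p j + K * b j)))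
      ≡⟨ cong (suc (o₀ + R * (p₀ + K * 0)) +_) (sumBelow-labels N R K o p b) ⟩
    suc (o₀ + R * (p₀ + K * 0)) + (N + sumBelow N o + R * (sumBelow N p + K * sumBelow N b))
      ≡⟨ assemble o₀ p₀ N (sumBelow N o) (sumBelow N p) (sumBelow N b) R K ⟩
    (1 + N) + (o₀ + sumBelow N o) + R * ((p₀ + sumBelow N p) + K * sumBelow N b)
      ≡⟨ cong₂ (λ O P → (1 + N) + O + R * (P + K * sumBelow N b))
               (trans (cong (λ m → o₀ + sumBelow m o) N≡2+n₁*2) (offset-row r (toℕ≤pred[2h+1] r t) (toℕ e) sd n₁))
               (trans (cong (λ m → p₀ + sumBelow m p) N≡2+n₁*2) (position-row s (toℕ≤pred[2h+1] s e) n₁)) ⟩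
    (1 + N) + (3 * r + n₁ * (2 * r)) + R * ((3 * s + n₁ * (2 * s)) + K * sumBelow N b)
      ≡⟨ cong₂ (λ O P → O + R * (P + K * sumBelow N b)) (outer r n₁) (inner s n₁) ⟩
    (1 + r) * (N + 1) + R * (s * (N + 1) + K * sumBelow N b)
      ≡⟨ cong (λ B → (1 + r) * (N + 1) + R * (s * (N + 1) + K * B)) (block-row sd N) ⟩
    endValue (toℕ sd) ∎
    where
    open ≡-Reasoning
    o p b : ℕ → ℕ
    o j = permute (spokeOffsetKind (toℕ e) sd j) r (toℕ t)
    p j = permute (spokePositionKind j) s (toℕ e)
    b j = block sd N j
    o₀ p₀ : ℕ
    o₀ = permute (tripleKind (toℕ e) 0F) r (toℕ t)
    p₀ = kotzig s (toℕ e)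
    outer : ∀ r n₁ → (1 + 2 * suc n₁) + (3 * r + n₁ * (2 * r)) ≡ (1 + r) * (2 * suc n₁ + 1)
    outer = solve-∀
    inner : ∀ s n₁ → 3 * s + n₁ * (2 * s) ≡ s * (2 * suc n₁ + 1)
    inner = solve-∀
    assemble : ∀ o₀ p₀ N O P B R K → suc (o₀ + R * (p₀ + K * 0)) + (N + O + R * (P + K * B))
                                     ≡ (1 + N) + (o₀ + O) + R * ((p₀ + P) + K * B)
    assemble = solve-∀

  hub-weight≡hubValue : ∀ t j → weight Γ (label labelling) (hub t j) ≡ hubValue
  hub-weight≡hubValue t j = begin
    weight Γ (label labelling) (hub t j)
      ≡⟨ weight-hub (label labelling) t j ⟩
    ∑[ e < K ] (label labelling (encode (t , e , spoke 0F j)) + (label labelling (encode (t , e , spoke 1F j)) + 0))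
      ≡⟨ sum-cong-≗ {K} (λ e → cong₂ (λ x y → x + (y + 0))
                                       (label-encode (t , e , spoke 0F j)) (label-encode (t , e , spoke 1F j))) ⟩
    sumBelow K (λ e → suc (o e + R * (p e + K * b)) + (suc (o′ e + R * (p e + K * b′)) + 0))
      ≡⟨ sumBelow-label-pairs K R K o o′ p b b′ ⟩
    K * 2 + sumBelow K (λ e → o e + o′ e) + R * (2 * sumBelow K p + K * (K * (b + b′)))
      ≡⟨ cong₂ (λ O P → K * 2 + O + R * (2 * P + K * (K * (b + b′))))
               (trans (cong (λ m → sumBelow m (λ e → o e + o′ e)) K≡3+s₁*2) (offset-column r (toℕ≤pred[2h+1] r t) (toℕ j) s₁))
               (trans (cong (λ m → sumBelow m p) (+-comm (2 * s) 1)) (position-column s (toℕ j))) ⟩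
    K * 2 + (2 * (3 * r) + s₁ * (2 * (2 * r))) + R * (2 * (s * suc (2 * s)) + K * (K * (b + b′)))
      ≡⟨ cong (λ B → K * 2 + (2 * (3 * r) + s₁ * (2 * (2 * r))) + R * (2 * (s * suc (2 * s)) + K * (K * B)))
              (block-column N (toℕ j) (toℕ<n j)) ⟩
    K * 2 + (2 * (3 * r) + s₁ * (2 * (2 * r))) + R * (2 * (s * suc (2 * s)) + K * (K * (1 + 2 * N)))
      ≡⟨ cong₂ (λ O P → O + R * P) (outer r s₁) (inner s N) ⟩
    hubValue ∎
    where
    open ≡-Reasoning
    o o′ p : ℕ → ℕ
    o e = permute (spokeOffsetKind e 0F (toℕ j)) r (toℕ t)
    o′ e = permute (spokeOffsetKind e 1F (toℕ j)) r (toℕ t)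
    p e = permute (spokePositionKind (toℕ j)) s e
    b b′ : ℕ
    b = block 0F N (toℕ j)
    b′ = block 1F N (toℕ j)
    outer : ∀ r s₁ → (2 * suc s₁ + 1) * 2 + (2 * (3 * r) + s₁ * (2 * (2 * r))) ≡ (1 + r) * (2 * (2 * suc s₁ + 1))
    outer = solve-∀
    inner : ∀ s N → 2 * (s * suc (2 * s)) + (2 * s + 1) * ((2 * s + 1) * (1 + 2 * N)) ≡ (2 * s + 1) * (2 * s + (2 * s + 1) * (2 * N + 1))
    inner = solve-∀
    K≡3+s₁*2 : K ≡ 3 + s₁ * 2
    K≡3+s₁*2 = odd s₁
      where
      odd : ∀ s → 2 * suc s + 1 ≡ 3 + s * 2
      odd = solve-∀

module Main (r s₁ n₁ : ℕ) where

  open VertexSums r s₁ n₁ public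

  colour-end : ∀ t e sd → fplus Γ labelling (end t e sd) ≡ endValue (toℕ sd)
  colour-end t e sd = trans (fplus≡weight Γ labelling _) (end-weight≡endValue t e sd)

  colour-hub : ∀ t j → fplus Γ labelling (hub t j) ≡ hubValue
  colour-hub t j = trans (fplus≡weight Γ labelling _) (hub-weight≡hubValue t j)

  private
    distinct : endValue 0 ≢ endValue 1 × endValue 0 ≢ hubValue × endValue 1 ≢ hubValue
    distinct = values-distinct z<s z<s

  colours-differ : ∀ p → fplus Γ labelling (proj₁ (ends Γ (encode p))) ≢ fplus Γ labelling (proj₂ (ends Γ (encode p)))
  colours-differ (t , e , rung)       =
    endpoint-colours-differ Γ labelling (ends-rung t e) (colour-end t e 0F) (colour-end t e 1F) (proj₁ distinct)
  colours-differ (t , e , spoke 0F j) =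
    endpoint-colours-differ Γ labelling (ends-spoke t e 0F j) (colour-end t e 0F) (colour-hub t j) (proj₁ (proj₂ distinct))
  colours-differ (t , e , spoke 1F j) =
    endpoint-colours-differ Γ labelling (ends-spoke t e 1F j) (colour-end t e 1F) (colour-hub t j) (proj₂ (proj₂ distinct))

  labelling-local-antimagic : IsLocalAntimagic Γ labelling
  labelling-local-antimagic = labelling-bijective , λ x →
    subst (λ y → fplus Γ labelling (proj₁ (ends Γ y)) ≢ fplus Γ labelling (proj₂ (ends Γ y)))
          (encode-decode x) (colours-differ (decode x))

  t₀ : Fin R
  t₀ = fromℕ< (0<odd r)
  e₀ : Fin K
  e₀ = fromℕ< (0<odd s)

  3≤colours : ∀ f → IsLocalAntimagic Γ f → 3 ≤ numColours Γ f
  3≤colours f antimagic = 3≤numColours Γ f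
    (separated Γ f antimagic (ends-rung t₀ e₀))
    (separated Γ f antimagic (ends-spoke t₀ e₀ 0F zero))
    (separated Γ f antimagic (ends-spoke t₀ e₀ 1F zero))

  colour∈values : ∀ {u} → Vertex u → fplus Γ labelling u ∈ (endValue 0 ∷ endValue 1 ∷ hubValue ∷ [])
  colour∈values (isEnd t e 0F) = here (colour-end t e 0F)
  colour∈values (isEnd t e 1F) = there (here (colour-end t e 1F))
  colour∈values (isHub t j)    = there (there (here (colour-hub t j)))

  labelling-colours : numColours Γ labelling ≡ 3
  labelling-colours = ≤-antisym (numColours≤ Γ labelling (colour∈values ∘ vertex)) (3≤colours labelling labelling-local-antimagic)

-- The construction only needs n ≥ 1 and s ≥ 1.
corollary2p5 : (n r s : ℕ) → 2 ≤ n → 1 ≤ r → 1 ≤ s →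
    LocalAntimagicChromaticNumber
      (copies (2 * r + 1) (copies (2 * s + 1) P₂ ∨G O (2 * n))) 3
corollary2p5 (suc n₁) r (suc s₁) _ _ _ = (labelling , labelling-local-antimagic , labelling-colours) , 3≤colours
  where open Main r s₁ n₁
corollary2p5 zero     r s        () _ _
corollary2p5 (suc n₁) r zero     _  _ ()
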